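{- Let $K$ be a quadratic number field in which $2$ is inert, let $\nu$ be the valuation of $K$ extending the $2$-adic valuation, with completion $K_\nu$ and valuation ring $A_\nu$, and take $\pi=2$ as uniformizer. Let $a,b_1,b_2\in\mathcal{O}_K$ be nonzero, $b=b_1b_2$, and let $C$ be the curve $v^2=b_1u^4+au^2w^2+b_2w^4$. Write $a=2^{\nu(a)}\alpha$, $b_1=2^{\nu(b_1)}\beta_1$, $b_2=2^{\nu(b_2)}\beta_2$ with $\alpha,\beta_1,\beta_2\in A_\nu^\times$, and suppose $\nu(a)>0$. Then $C(K_\nu)\neq\emptyset$ if one of the following holds: (1) for some $i\in\{1,2\}$, $\nu(b_i)$ is even and $\beta_i^3$ reduces to $1$ or $5$ modulo $8A_\nu$; in particular, if $b_1,b_2\in\mathbb{Z}_2$, then $\nu(b_i)$ even and $\beta_i\equiv 1\pmod{4A_\nu}$ is sufficient; (2) $\min\{\nu(b_1)-\nu(a),\nu(b_2)-\nu(a)\}\ge 3$, $\nu(a)$ is even, and $\alpha^3$ reduces to $1$ or $5$ modulo $8A_\nu$; in particular, if $a\in\mathbb{Z}_2$, then (with the other two conditions) $\alpha\equiv 1\pmod{4A_\nu}$ is sufficient; (3) $\nu(b_1)+\nu(b_2)-2\nu(a)\ge 3$, $\nu(a)$ is even, and for some $i\in\{1,2\}$, $\nu(b_i)$ is even and $(\alpha+\beta_i)^3$ reduces to $1$ or $5$ modulo $8A_\nu$.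
   Context: $K_\nu$ is an unramified quadratic extension of $\mathbb{Q}_2$ and contains $\mathbb{Z}_2$. $C(K_\nu)\neq\emptyset$ means there exist $u,v,w\in K_\nu$ with $(u,w)\neq(0,0)$ satisfying $v^2=b_1u^4+au^2w^2+b_2w^4$. -}

module Defs where

open import Data.Nat as ℕ using (ℕ; zero; suc; _≤_)
open import Data.Nat.Divisibility as ℕD using ()
open import Data.Integer as ℤ using (ℤ; +_; _-_; ∣_∣)
open import Data.Integer.DivMod using (_/_; _%_)
open import Data.Integer.Divisibility as ℤD using ()
open import Data.Product using (Σ; _×_; _,_)
open import Data.Sum using (_⊎_)
open import Relation.Nullary using (¬_)
open import Relation.Binary.PropositionalEquality using (_≡_)

-- The quadratic field K = ℚ(√d), d squarefree.  2 is inert in K iff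
-- d ≡ 5 (mod 8).  Then d ≡ 1 (mod 4), O_K = ℤ[θ] with θ = (1+√d)/2,
-- θ² = θ + c where c = (d-1)/4.

SquareFree : ℤ → Set
SquareFree d = ∀ (p : ℕ) → (p ℕ.* p) ℕD.∣ ∣ d ∣ → p ≡ 1

TwoInert : ℤ → Set
TwoInert d = d % (+ 8) ≡ 5

cOf : ℤ → ℤ
cOf d = (d - + 1) / (+ 4)

record OK : Set where
  constructor _⊕_θ
  field re im : ℤ
open OK public

module Arith (c : ℤ) where
  infixl 6 _+ₖ_
  infixl 7 _*ₖ_ _·_

  _+ₖ_ : OK → OK → OK
  (a ⊕ b θ) +ₖ (x ⊕ y θ) = (a ℤ.+ x) ⊕ (b ℤ.+ y) θ

  -- (a + bθ)(x + yθ) = ax + (ay + bx)θ + by θ²,  θ² = θ + c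
  _*ₖ_ : OK → OK → OK
  (a ⊕ b θ) *ₖ (x ⊕ y θ) =
    (a ℤ.* x ℤ.+ b ℤ.* y ℤ.* c) ⊕ (a ℤ.* y ℤ.+ b ℤ.* x ℤ.+ b ℤ.* y) θ

  _·_ : ℤ → OK → OK
  n · (x ⊕ y θ) = (n ℤ.* x) ⊕ (n ℤ.* y) θ

  fromℤ : ℤ → OK
  fromℤ n = n ⊕ (+ 0) θ

  cube : OK → OK
  cube x = x *ₖ x *ₖ x

_≡_[modₖ_] : OK → OK → ℤ → Set
x ≡ y [modₖ m ] = (m ℤD.∣ (re x - re y)) × (m ℤD.∣ (im x - im y))

IsUnit₂ : OK → Set
IsUnit₂ x = ¬ (x ≡ ((+ 0) ⊕ (+ 0) θ) [modₖ (+ 2) ])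

pow2 : ℕ → ℤ
pow2 n = + (2 ℕ.^ n)

-- The valuation ring A_ν = O_K ⊗ ℤ₂ = lim O_K / 2ⁿ O_K, as coherent
-- sequences; K_ν = A_ν[1/2] as fractions X / 2^k.

record Aν : Set where
  field
    seq : ℕ → OK
    coh : ∀ n → seq (suc n) ≡ seq n [modₖ pow2 n ]
open Aν public

infix 4 _≈A_
_≈A_ : (ℕ → OK) → (ℕ → OK) → Set
f ≈A g = ∀ n → f n ≡ g n [modₖ pow2 n ]

record Kν : Set where
  constructor _/2^_
  field
    num : Aν
    den : ℕ
open Kν public

module KArith (c : ℤ) where
  open Arith c

  private
    scale : ℕ → (ℕ → OK) → ℕ → OK
    scale e f n = pow2 e · f n

  -- formal expressions in K_ν, as (numerator sequence, exponent of denominator)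
  record KRaw : Set where
    constructor raw
    field
      rnum : ℕ → OK
      rden : ℕ
  open KRaw

  ⌜_⌝ : Kν → KRaw
  ⌜ x ⌝ = raw (seq (num x)) (den x)

  embed : OK → KRaw
  embed a = raw (λ _ → a) 0

  _+K_ : KRaw → KRaw → KRaw
  raw f i +K raw g j = raw (λ n → scale j f n +ₖ scale i g n) (i ℕ.+ j)

  _*K_ : KRaw → KRaw → KRaw
  raw f i *K raw g j = raw (λ n → f n *ₖ g n) (i ℕ.+ j)

  infixl 6 _+K_
  infixl 7 _*K_
  infix 4 _≈K_

  _≈K_ : KRaw → KRaw → Set
  raw f i ≈K raw g j = scale j f ≈A scale i g

  0K : KRaw
  0K = raw (λ _ → (+ 0) ⊕ (+ 0) θ) 0

  OnC : OK → OK → OK → Kν → Kν → Kν → Set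
  OnC a b₁ b₂ u v w =
    (⌜ v ⌝ *K ⌜ v ⌝ ≈K
      (embed b₁ *K ⌜ u ⌝ *K ⌜ u ⌝ *K ⌜ u ⌝ *K ⌜ u ⌝
       +K embed a *K ⌜ u ⌝ *K ⌜ u ⌝ *K ⌜ w ⌝ *K ⌜ w ⌝
       +K embed b₂ *K ⌜ w ⌝ *K ⌜ w ⌝ *K ⌜ w ⌝ *K ⌜ w ⌝))
    × ¬ ((⌜ u ⌝ ≈K 0K) × (⌜ w ⌝ ≈K 0K))

CHasKνPoint : ℤ → OK → OK → OK → Set
CHasKνPoint c a b₁ b₂ =
  Σ Kν λ u → Σ Kν λ v → Σ Kν λ w → KArith.OnC c a b₁ b₂ u v w

-- Hypotheses (1), (2), (3) of Lemma 3.4, with the "in particular" cases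
-- (1'), (2').  Here kₐ, k₁, k₂ stand for ν(a), ν(b₁), ν(b₂) and α, β₁, β₂
-- for the unit parts.

module Conds (c : ℤ) where
  open Arith c

  EvenN : ℕ → Set
  EvenN k = 2 ℕD.∣ k

  Cube15 : OK → Set
  Cube15 x = (cube x ≡ fromℤ (+ 1) [modₖ (+ 8) ]) ⊎ (cube x ≡ fromℤ (+ 5) [modₖ (+ 8) ])

  -- x ∈ ℤ₂  (for x ∈ O_K: x ∈ O_K ∩ ℚ₂ = ℤ)
  InZ₂ : OK → Set
  InZ₂ x = im x ≡ + 0

  Cond1 : ℕ → ℕ → OK → OK → Set
  Cond1 k₁ k₂ β₁ β₂ = (EvenN k₁ × Cube15 β₁) ⊎ (EvenN k₂ × Cube15 β₂)

  Cond1' : OK → OK → ℕ → ℕ → OK → OK → Set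
  Cond1' b₁ b₂ k₁ k₂ β₁ β₂ =
    (InZ₂ b₁ × EvenN k₁ × (β₁ ≡ fromℤ (+ 1) [modₖ (+ 4) ]))
    ⊎ (InZ₂ b₂ × EvenN k₂ × (β₂ ≡ fromℤ (+ 1) [modₖ (+ 4) ]))

  Cond2 : ℕ → ℕ → ℕ → OK → Set
  Cond2 kₐ k₁ k₂ α = (kₐ ℕ.+ 3 ≤ k₁) × (kₐ ℕ.+ 3 ≤ k₂) × EvenN kₐ × Cube15 α

  Cond2' : OK → ℕ → ℕ → ℕ → OK → Set
  Cond2' a kₐ k₁ k₂ α =
    (kₐ ℕ.+ 3 ≤ k₁) × (kₐ ℕ.+ 3 ≤ k₂) × EvenN kₐ
    × InZ₂ a × (α ≡ fromℤ (+ 1) [modₖ (+ 4) ])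

  Cond3 : ℕ → ℕ → ℕ → OK → OK → OK → Set
  Cond3 kₐ k₁ k₂ α β₁ β₂ =
    (2 ℕ.* kₐ ℕ.+ 3 ≤ k₁ ℕ.+ k₂) × EvenN kₐ
    × ((EvenN k₁ × Cube15 (α +ₖ β₁)) ⊎ (EvenN k₂ × Cube15 (α +ₖ β₂)))

  AnyCond : OK → OK → OK → ℕ → ℕ → ℕ → OK → OK → OK → Set
  AnyCond a b₁ b₂ kₐ k₁ k₂ α β₁ β₂ =
    Cond1 k₁ k₂ β₁ β₂ ⊎ Cond1' b₁ b₂ k₁ k₂ β₁ β₂
    ⊎ Cond2 kₐ k₁ k₂ α ⊎ Cond2' a kₐ k₁ k₂ α
    ⊎ Cond3 kₐ k₁ k₂ α β₁ β₂

0ₖ : OK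
0ₖ = (+ 0) ⊕ (+ 0) θ

-- Each condition yields a nontrivial (u, w) ∈ O_K² at which the quartic
-- F(u, w) = b₁u⁴ + a u²w² + b₂w⁴ equals 4^T z for a unit z that is a square modulo 8:
-- (1) takes (u, w) = (1, 0), (2) takes (1, 1), and (3) takes (2^m, 2^m₁) where ν(a) = 2m and
-- ν(b₁) = 2m₁, so that z ≡ α + β₁ (mod 8).  A unit z with z³ ≡ k ∈ {1, 5} (mod 8) satisfies
-- z ≡ k z⁴, and 5 ≡ (1 + 2θ)² because θ² = θ + c with c odd, which is where the inertness of 2
-- enters.  Newton's iteration s ↦ s + (z − s²)/(2s), with 1/s replaced by s², lifts a square
-- root of z modulo 8 to a coherent sequence of square roots modulo 2ⁿ, i.e. to √z ∈ A_ν, and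
-- (u, 2^T √z, w) is the required point.

module Submission where

open import Defs
open import Data.Nat using (ℕ; _<_)
open import Data.Integer using (ℤ)
open import Relation.Nullary using (¬_)
open import Relation.Binary.PropositionalEquality using (_≡_)

open import Level using (0ℓ)
open import Function using (_∘_)
open import Data.Unit using (⊤; tt)
open import Data.Empty using (⊥-elim)
open import Data.Nat as ℕ using (zero; suc; _^_; _≤_)
import Data.Nat.Properties as ℕ
import Data.Nat.Divisibility as ℕ
import Data.Nat.Literals
import Data.Nat.Tactic.RingSolver
open import Data.Integer as ℤ using (+_; ∣_∣)
import Data.Integer.Properties as ℤ
import Data.Integer.Divisibility as ℤᵘ
import Data.Integer.Divisibility.Signed as ℤ
open import Data.Integer.DivMod using (_/_; _%_; a≡a%n+[a/n]*n; n%d<d)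
open import Data.List using ([]; _∷_)
open import Data.Maybe using (Maybe; just; nothing)
open import Data.Product using (Σ; ∃; _×_; _,_; proj₁; proj₂)
open import Data.Sum using (_⊎_; inj₁; inj₂; [_,_]′)
open import Relation.Binary.PropositionalEquality
  using (refl; sym; trans; cong; cong₂; subst; subst₂; isEquivalence; module ≡-Reasoning)
open ≡-Reasoning
open import Algebra.Bundles using (CommutativeRing)
open import Algebra.Structures {A = OK} _≡_ using (IsCommutativeRing)
import Algebra.Definitions.RawMagma as Divisibility
open import Tactic.RingSolver.Core.AlmostCommutativeRing
  using (AlmostCommutativeRing; fromCommutativeRing)

module _ where
  open import Data.Integer using (_+_; _-_; _*_)
  open import Data.Integer.Tactic.RingSolver using (solve-∀)

  n<2^n : ∀ n → n ℕ.< 2 ^ n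
  n<2^n zero    = ℕ.s≤s ℕ.z≤n
  n<2^n (suc n) = ℕ.+-mono-≤ (ℕ.m^n>0 2 n) (ℕ.≤-trans (n<2^n n) (ℕ.m≤m+n (2 ^ n) 0))

  2^n∣n⇒n≡0 : ∀ n → 2 ^ n ℕ.∣ n → n ≡ 0
  2^n∣n⇒n≡0 zero    _   = refl
  2^n∣n⇒n≡0 (suc n) 2^n∣n = ⊥-elim (ℕ.>⇒∤ (n<2^n (suc n)) 2^n∣n)

  ℤ-2-adically-separated : ∀ {x} → (∀ n → pow2 n ℤᵘ.∣ x) → x ≡ + 0
  ℤ-2-adically-separated {x} 2^n∣x = ℤ.∣i∣≡0⇒i≡0 (2^n∣n⇒n≡0 ∣ x ∣ (2^n∣x ∣ x ∣))

  [m*n]/n≡m : ∀ m n .{{_ : ℕ.NonZero n}} → (m * + n) / + n ≡ m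
  [m*n]/n≡m m n = ℤ.*-cancelʳ-≡ q m (+ n) (begin
    q * + n               ≡⟨ sym (ℤ.+-identityˡ (q * + n)) ⟩
    + 0 + q * + n         ≡⟨ cong (λ r → + r + q * + n) r≡0 ⟨
    + r + q * + n         ≡⟨ a≡a%n+[a/n]*n (m * + n) (+ n) ⟨
    m * + n               ∎)
    where
    q = (m * + n) / + n
    r = (m * + n) % + n
    r≡[m-q]n : + r ≡ (m - q) * + n
    r≡[m-q]n = begin
      + r                   ≡⟨ split (+ r) (q * + n) ⟩
      (+ r + q * + n) - q * + n ≡⟨ cong (_- q * + n) (a≡a%n+[a/n]*n (m * + n) (+ n)) ⟨
      m * + n - q * + n     ≡⟨ factor m q (+ n) ⟩
      (m - q) * + n         ∎
      where
      split : ∀ a b → a ≡ (a + b) - b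
      split = solve-∀
      factor : ∀ a b c → a * c - b * c ≡ (a - b) * c
      factor = solve-∀
    r≡0 : r ≡ 0
    r≡0 with r | r≡[m-q]n | n%d<d (m * + n) (+ n)
    ... | zero  | _  | _   = refl
    ... | suc _ | eq | r<n = ⊥-elim (ℕ.>⇒∤ r<n (ℤ.∣⇒∣ᵤ (ℤ.divides (m - q) eq)))

  Odd : ℤ → Set
  Odd x = ∃ λ j → x ≡ + 2 * j + + 1

  cOf-odd : ∀ d → TwoInert d → Odd (cOf d)
  cOf-odd d d%8≡5 = q , (begin
    (d - + 1) / + 4                    ≡⟨ cong (_/ + 4) d-1≡[2q+1]4 ⟩
    ((+ 2 * q + + 1) * + 4) / + 4      ≡⟨ [m*n]/n≡m (+ 2 * q + + 1) 4 ⟩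
    + 2 * q + + 1                      ∎)
    where
    q = d / + 8
    d-1≡[2q+1]4 : d - + 1 ≡ (+ 2 * q + + 1) * + 4
    d-1≡[2q+1]4 = begin
      d - + 1                    ≡⟨ cong (_- + 1) (a≡a%n+[a/n]*n d (+ 8)) ⟩
      (+ (d % + 8) + q * + 8) - + 1 ≡⟨ cong (λ r → (+ r + q * + 8) - + 1) d%8≡5 ⟩
      (+ 5 + q * + 8) - + 1      ≡⟨ regroup q ⟩
      (+ 2 * q + + 1) * + 4      ∎
      where
      regroup : ∀ q → (+ 5 + q * + 8) - + 1 ≡ (+ 2 * q + + 1) * + 4
      regroup = solve-∀

  even-or-odd : ∀ x → ∃ λ g → x ≡ g * + 2 ⊎ x ≡ g * + 2 + + 1
  even-or-odd x with x % + 2 | a≡a%n+[a/n]*n x (+ 2) | n%d<d x (+ 2)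
  ... | 0 | x≡ | _ = x / + 2 , inj₁ (trans x≡ (ℤ.+-identityˡ _))
  ... | 1 | x≡ | _ = x / + 2 , inj₂ (trans x≡ (ℤ.+-comm (+ 1) (x / + 2 * + 2)))
  ... | suc (suc _) | _ | ℕ.s≤s (ℕ.s≤s ())

  ≡1mod4⇒≡1or5mod8 : ∀ x → + 4 ℤᵘ.∣ x - + 1 → + 8 ℤᵘ.∣ x - + 1 ⊎ + 8 ℤᵘ.∣ x - + 5
  ≡1mod4⇒≡1or5mod8 x 4∣x-1 with ℤ.∣ᵤ⇒∣ {+ 4} {x - + 1} 4∣x-1
  ... | ℤ.divides q x-1≡q4 with even-or-odd q
  ...   | g , inj₁ q≡2g = inj₁ (ℤ.∣⇒∣ᵤ {+ 8} {x - + 1} (ℤ.divides g (begin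
    x - + 1                         ≡⟨ x-1≡q4 ⟩
    q * + 4                         ≡⟨ cong (_* + 4) q≡2g ⟩
    g * + 2 * + 4                   ≡⟨ even g ⟩
    g * + 8                         ∎)))
    where
    even : ∀ g → g * + 2 * + 4 ≡ g * + 8
    even = solve-∀
  ...   | g , inj₂ q≡2g+1 = inj₂ (ℤ.∣⇒∣ᵤ {+ 8} {x - + 5} (ℤ.divides g (begin
    x - + 5                         ≡⟨ shift x ⟩
    (x - + 1) - + 4                 ≡⟨ cong (_- + 4) x-1≡q4 ⟩
    q * + 4 - + 4                   ≡⟨ cong (λ q → q * + 4 - + 4) q≡2g+1 ⟩
    (g * + 2 + + 1) * + 4 - + 4     ≡⟨ odd g ⟩
    g * + 8                         ∎)))
    where
    shift : ∀ x → x - + 5 ≡ (x - + 1) - + 4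
    shift = solve-∀
    odd : ∀ g → (g * + 2 + + 1) * + 4 - + 4 ≡ g * + 8
    odd = solve-∀

module _ where
  open import Data.Nat using (_+_; _*_)
  open Data.Nat.Tactic.RingSolver using (solve)

  condition3-exponents : ∀ {kₐ k₁} k₂ m m₁ r → kₐ ≡ m * 2 → k₁ ≡ m₁ * 2 → 2 * kₐ + 3 + r ≡ k₁ + k₂ →
                         let T = m + m + m₁ in
                         k₁ + (m + m + m + m) ≡ T + T × kₐ + (m + m + m₁ + m₁) ≡ T + T
                         × k₂ + (m₁ + m₁ + m₁ + m₁) ≡ T + T + 3 + r
  condition3-exponents k₂ m m₁ r refl refl 2kₐ+3+r≡k₁+k₂ =
    solve (m ∷ m₁ ∷ []) , solve (m ∷ m₁ ∷ []) , ℕ.+-cancelʳ-≡ (m₁ * 2) _ _ (begin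
      k₂ + (m₁ + m₁ + m₁ + m₁) + m₁ * 2                ≡⟨ solve (k₂ ∷ m₁ ∷ []) ⟩
      (m₁ * 2 + k₂) + (m₁ + m₁ + m₁ + m₁)              ≡⟨ cong (_+ (m₁ + m₁ + m₁ + m₁)) 2kₐ+3+r≡k₁+k₂ ⟨
      (2 * (m * 2) + 3 + r) + (m₁ + m₁ + m₁ + m₁)      ≡⟨ solve (m ∷ m₁ ∷ r ∷ []) ⟩
      (m + m + m₁) + (m + m + m₁) + 3 + r + m₁ * 2     ∎)

-- O_K = ℤ[θ] as a commutative ring

private
  module ComponentIdentities where
    open import Data.Integer using (_+_; _*_)
    open import Data.Integer.Tactic.RingSolver using (solve-∀)
    re-*-assoc : ∀ a b x y u v c → (a * x + b * y * c) * u + (a * y + b * x + b * y) * v * c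
                                 ≡ a * (x * u + y * v * c) + b * (x * v + y * u + y * v) * c
    re-*-assoc = solve-∀
    im-*-assoc : ∀ a b x y u v c → (a * x + b * y * c) * v + (a * y + b * x + b * y) * u + (a * y + b * x + b * y) * v
                                 ≡ a * (x * v + y * u + y * v) + b * (x * u + y * v * c) + b * (x * v + y * u + y * v)
    im-*-assoc = solve-∀
    re-*-comm : ∀ a b x y c → a * x + b * y * c ≡ x * a + y * b * c
    re-*-comm = solve-∀
    im-*-comm : ∀ a b x y → a * y + b * x + b * y ≡ x * b + y * a + y * b
    im-*-comm = solve-∀
    re-*-identityˡ : ∀ a b c → + 1 * a + + 0 * b * c ≡ a
    re-*-identityˡ = solve-∀
    im-*-identityˡ : ∀ a b → + 1 * b + + 0 * a + + 0 * b ≡ b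
    im-*-identityˡ = solve-∀
    re-distribˡ : ∀ a b x y u v c → a * (x + u) + b * (y + v) * c ≡ (a * x + b * y * c) + (a * u + b * v * c)
    re-distribˡ = solve-∀
    im-distribˡ : ∀ a b x y u v → a * (y + v) + b * (x + u) + b * (y + v) ≡ (a * y + b * x + b * y) + (a * v + b * u + b * v)
    im-distribˡ = solve-∀
    re-fromℤ-* : ∀ m x y c → m * x ≡ m * x + + 0 * y * c
    re-fromℤ-* = solve-∀
    im-fromℤ-* : ∀ m x y → m * y ≡ m * y + + 0 * x + + 0 * y
    im-fromℤ-* = solve-∀

module TwoAdic (c : ℤ) where
  open import Agda.Builtin.FromNat using (Number; fromNat)
  open import Tactic.RingSolver using (solve-∀; solve)
  open Arith c public
  open Conds c using (EvenN; Cube15)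
  open ComponentIdentities

  instance
    ℕ-number : Number ℕ
    ℕ-number = Data.Nat.Literals.number

  negₖ : OK → OK
  negₖ (x ⊕ y θ) = (ℤ.- x) ⊕ (ℤ.- y) θ

  isCommutativeRing : IsCommutativeRing _+ₖ_ _*ₖ_ negₖ (fromℤ (+ 0)) (fromℤ (+ 1))
  isCommutativeRing = record
    { isRing = record
      { +-isAbelianGroup = record
        { isGroup = record
          { isMonoid = record
            { isSemigroup = record
              { isMagma = record { isEquivalence = isEquivalence ; ∙-cong = cong₂ _+ₖ_ }
              ; assoc = λ { (a ⊕ b θ) (x ⊕ y θ) (u ⊕ v θ) → cong₂ _⊕_θ (ℤ.+-assoc a x u) (ℤ.+-assoc b y v) } }
            ; identity = (λ { (a ⊕ b θ) → cong₂ _⊕_θ (ℤ.+-identityˡ a) (ℤ.+-identityˡ b) })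
                       , (λ { (a ⊕ b θ) → cong₂ _⊕_θ (ℤ.+-identityʳ a) (ℤ.+-identityʳ b) }) }
          ; inverse = (λ { (a ⊕ b θ) → cong₂ _⊕_θ (ℤ.+-inverseˡ a) (ℤ.+-inverseˡ b) })
                    , (λ { (a ⊕ b θ) → cong₂ _⊕_θ (ℤ.+-inverseʳ a) (ℤ.+-inverseʳ b) })
          ; ⁻¹-cong = cong negₖ }
        ; comm = λ { (a ⊕ b θ) (x ⊕ y θ) → cong₂ _⊕_θ (ℤ.+-comm a x) (ℤ.+-comm b y) } }
      ; *-cong = cong₂ _*ₖ_
      ; *-assoc = λ { (a ⊕ b θ) (x ⊕ y θ) (u ⊕ v θ) →
                      cong₂ _⊕_θ (re-*-assoc a b x y u v c) (im-*-assoc a b x y u v c) }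
      ; *-identity = *ₖ-identityˡ , λ x → trans (*ₖ-comm x _) (*ₖ-identityˡ x)
      ; distrib = *ₖ-distribˡ , λ x y z → trans (*ₖ-comm (y +ₖ z) x)
                                         (trans (*ₖ-distribˡ x y z) (cong₂ _+ₖ_ (*ₖ-comm x y) (*ₖ-comm x z))) }
    ; *-comm = *ₖ-comm }
    where
    *ₖ-comm : ∀ x y → x *ₖ y ≡ y *ₖ x
    *ₖ-comm (a ⊕ b θ) (x ⊕ y θ) = cong₂ _⊕_θ (re-*-comm a b x y c) (im-*-comm a b x y)
    *ₖ-identityˡ : ∀ x → fromℤ (+ 1) *ₖ x ≡ x
    *ₖ-identityˡ (a ⊕ b θ) = cong₂ _⊕_θ (re-*-identityˡ a b c) (im-*-identityˡ a b)
    *ₖ-distribˡ : ∀ x y z → x *ₖ (y +ₖ z) ≡ x *ₖ y +ₖ x *ₖ z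
    *ₖ-distribˡ (a ⊕ b θ) (x ⊕ y θ) (u ⊕ v θ) =
      cong₂ _⊕_θ (re-distribˡ a b x y u v c) (im-distribˡ a b x y u v)

  commutativeRing : CommutativeRing 0ℓ 0ℓ
  commutativeRing = record { isCommutativeRing = isCommutativeRing }

  ring : AlmostCommutativeRing 0ℓ 0ℓ
  ring = fromCommutativeRing commutativeRing isZero
    where
    isZero : ∀ x → Maybe (fromℤ (+ 0) ≡ x)
    isZero ((+ 0) ⊕ (+ 0) θ) = just refl
    isZero _                 = nothing

  open AlmostCommutativeRing ring public
    using (_+_; _*_; -_; 0#; 1#; *-comm) renaming (_-_ to infixl 6 _-_)
  open Divisibility (CommutativeRing.*-rawMagma commutativeRing) public using (_∣_; _,_)

  instance
    OK-number : Number OK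
    OK-number = record { Constraint = λ _ → ⊤ ; fromNat = λ n → fromℤ (+ n) }

  2^_ : ℕ → OK
  2^ n = fromℤ (pow2 n)

  fromℤ-* : ∀ m n → fromℤ (m ℤ.* n) ≡ fromℤ m * fromℤ n
  fromℤ-* m n = cong₂ _⊕_θ (re-fromℤ-* m n (+ 0) c) (trans (sym (ℤ.*-zeroʳ m)) (im-fromℤ-* m n (+ 0)))

  2^-+ : ∀ m n → 2^ (m ℕ.+ n) ≡ 2^ m * 2^ n
  2^-+ m n = trans (cong (λ k → fromℤ (+ k)) (ℕ.^-distribˡ-+-* 2 m n))
                   (trans (cong fromℤ (ℤ.pos-* (2 ^ m) (2 ^ n))) (fromℤ-* (pow2 m) (pow2 n)))

  ·-as-* : ∀ m x → m · x ≡ fromℤ m * x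
  ·-as-* m (x ⊕ y θ) = cong₂ _⊕_θ (re-fromℤ-* m x y c) (im-fromℤ-* m x y)

  pow2-0·x≡x : ∀ x → pow2 0 · x ≡ x
  pow2-0·x≡x (x ⊕ y θ) = cong₂ _⊕_θ (ℤ.*-identityˡ x) (ℤ.*-identityˡ y)

  ∣⇒≡[modₖ] : ∀ m x y → fromℤ m ∣ x - y → x ≡ y [modₖ m ]
  ∣⇒≡[modₖ] m x y (q , q*m≡x-y) =
      ℤ.∣⇒∣ᵤ {m} {re x ℤ.- re y} (ℤ.divides (re q) (trans (sym (cong re m·q≡x-y)) (ℤ.*-comm m (re q))))
    , ℤ.∣⇒∣ᵤ {m} {im x ℤ.- im y} (ℤ.divides (im q) (trans (sym (cong im m·q≡x-y)) (ℤ.*-comm m (im q))))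
    where
    m·q≡x-y : m · q ≡ x - y
    m·q≡x-y = trans (·-as-* m q) (trans (*-comm (fromℤ m) q) q*m≡x-y)

  ≡[modₖ]⇒∣ : ∀ m x y → x ≡ y [modₖ m ] → fromℤ m ∣ x - y
  ≡[modₖ]⇒∣ m x y (m∣re , m∣im)
    with ℤ.∣ᵤ⇒∣ {m} {re x ℤ.- re y} m∣re | ℤ.∣ᵤ⇒∣ {m} {im x ℤ.- im y} m∣im
  ... | ℤ.divides q₁ re≡ | ℤ.divides q₂ im≡ = q , (begin
    q * fromℤ m  ≡⟨ *-comm q (fromℤ m) ⟩
    fromℤ m * q  ≡⟨ ·-as-* m q ⟨
    m · q        ≡⟨ cong₂ _⊕_θ (trans (ℤ.*-comm m q₁) (sym re≡)) (trans (ℤ.*-comm m q₂) (sym im≡)) ⟩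
    x - y        ∎)
    where
    q = q₁ ⊕ q₂ θ

  2-adically-separated : ∀ {x y} → (∀ n → x ≡ y [modₖ pow2 n ]) → x ≡ y
  2-adically-separated {x} {y} x≡y =
    cong₂ _⊕_θ (ℤ.i-j≡0⇒i≡j (re x) (re y) (ℤ-2-adically-separated (λ n → proj₁ (x≡y n))))
               (ℤ.i-j≡0⇒i≡j (im x) (im y) (ℤ-2-adically-separated (λ n → proj₂ (x≡y n))))

  -- Squares modulo 8

  -- s is a unit modulo 2, with inverse s².
  Cube≡1₂ : OK → Set
  Cube≡1₂ s = 2 ∣ 1 - s * s * s

  record ApproxSqrt (z : OK) (n : ℕ) (s : OK) : Set where
    field
      residual : 2^ n * 8 ∣ z - s * s
      cube≡1   : Cube≡1₂ s

  SquareMod8 : OK → Set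
  SquareMod8 z = Σ OK (ApproxSqrt z 0)

  cube≡1₂-* : ∀ {x y} → Cube≡1₂ x → Cube≡1₂ y → Cube≡1₂ (x * y)
  cube≡1₂-* {x} {y} (p , p2≡) (q , q2≡) = p + x * x * x * q , (begin
    (p + x * x * x * q) * 2           ≡⟨ solve (p ∷ q ∷ x ∷ []) ring ⟩
    p * 2 + x * x * x * (q * 2)       ≡⟨ cong₂ (λ u v → u + x * x * x * v) p2≡ q2≡ ⟩
    (1 - x * x * x) + x * x * x * (1 - y * y * y) ≡⟨ solve (x ∷ y ∷ []) ring ⟩
    1 - x * y * (x * y) * (x * y)     ∎)

  cube≡1₂-resp : ∀ {s s'} → Cube≡1₂ s → 2 ∣ s' - s → Cube≡1₂ s'
  cube≡1₂-resp {s} {s'} (f , f2≡) (d , d2≡) = f - d * (s' * s' + s' * s + s * s) , (begin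
    (f - d * (s' * s' + s' * s + s * s)) * 2        ≡⟨ solve (f ∷ d ∷ s ∷ s' ∷ []) ring ⟩
    f * 2 - d * 2 * (s' * s' + s' * s + s * s)      ≡⟨ cong₂ (λ u v → u - v * (s' * s' + s' * s + s * s)) f2≡ d2≡ ⟩
    (1 - s * s * s) - (s' - s) * (s' * s' + s' * s + s * s) ≡⟨ solve (s ∷ s' ∷ []) ring ⟩
    1 - s' * s' * s'                                ∎)

  squareMod8-square : ∀ {s} → Cube≡1₂ s → SquareMod8 (s * s)
  squareMod8-square {s} s³≡1 = s , record
    { residual = 0 , solve (s ∷ []) ring
    ; cube≡1   = s³≡1 }

  squareMod8-1 : SquareMod8 1
  squareMod8-1 = squareMod8-square {1} (0 , refl)

  squareMod8-* : ∀ {x y} → SquareMod8 x → SquareMod8 y → SquareMod8 (x * y)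
  squareMod8-* {x} {y} (s , record { residual = p , p8≡ ; cube≡1 = s³≡1 })
                       (t , record { residual = q , q8≡ ; cube≡1 = t³≡1 }) = s * t , record
    { residual = p * y + s * s * q , (begin
        (p * y + s * s * q) * 8                 ≡⟨ solve (p ∷ q ∷ s ∷ y ∷ []) ring ⟩
        p * 8 * y + s * s * (q * 8)             ≡⟨ cong₂ (λ u v → u * y + s * s * v) p8≡ q8≡ ⟩
        (x - s * s) * y + s * s * (y - t * t)   ≡⟨ solve (x ∷ y ∷ s ∷ t ∷ []) ring ⟩
        x * y - s * t * (s * t)                 ∎)
    ; cube≡1 = cube≡1₂-* {s} {t} s³≡1 t³≡1 }

  squareMod8-resp : ∀ {x y} → 8 ∣ x - y → SquareMod8 y → SquareMod8 x
  squareMod8-resp {x} {y} (d , d8≡) (s , record { residual = p , p8≡ ; cube≡1 = s³≡1 }) = s , record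
    { residual = d + p , (begin
        (d + p) * 8                 ≡⟨ solve (d ∷ p ∷ []) ring ⟩
        d * 8 + p * 8               ≡⟨ cong₂ _+_ d8≡ p8≡ ⟩
        (x - y) + (y - s * s)       ≡⟨ solve (x ∷ y ∷ s ∷ []) ring ⟩
        x - s * s                   ∎)
    ; cube≡1 = s³≡1 }

  squareMod8-+8* : ∀ {γ} → SquareMod8 γ → ∀ w → SquareMod8 (γ + 8 * w)
  squareMod8-+8* {γ} γ-square w = squareMod8-resp {γ + 8 * w} {γ} (w , solve (γ ∷ w ∷ []) ring) γ-square

  squareMod8-cubeRoot : ∀ {z} k → 2 ∣ 1 - k → 8 ∣ 1 - k * k → SquareMod8 k →
                        8 ∣ z * z * z - k → SquareMod8 z
  squareMod8-cubeRoot {z} k (e , e2≡) (r , r8≡) k-square (q , q8≡) =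
    squareMod8-resp z≡kz⁴ (squareMod8-* k-square (squareMod8-square {z * z} (cube≡1₂-* {z} {z} z³≡1 z³≡1)))
    where
    z³≡1 : Cube≡1₂ z
    z³≡1 = e - 4 * q , (begin
      (e - 4 * q) * 2                 ≡⟨ solve (e ∷ q ∷ []) ring ⟩
      e * 2 - q * 8                   ≡⟨ cong₂ _-_ e2≡ q8≡ ⟩
      (1 - k) - (z * z * z - k)       ≡⟨ solve (z ∷ k ∷ []) ring ⟩
      1 - z * z * z                   ∎)
    z≡kz⁴ : 8 ∣ z - k * (z * z * (z * z))
    z≡kz⁴ = z * r - k * z * q , (begin
      (z * r - k * z * q) * 8                     ≡⟨ solve (z ∷ r ∷ k ∷ q ∷ []) ring ⟩
      z * (r * 8) - k * z * (q * 8)               ≡⟨ cong₂ (λ u v → z * u - k * z * v) r8≡ q8≡ ⟩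
      z * (1 - k * k) - k * z * (z * z * z - k)   ≡⟨ solve (z ∷ k ∷ []) ring ⟩
      z - k * (z * z * (z * z))                   ∎)

  θ : OK
  θ = (+ 0) ⊕ (+ 1) θ

  θ*θ≡θ+c : θ * θ ≡ θ + fromℤ c
  θ*θ≡θ+c = cong₂ _⊕_θ (cong (ℤ._+_ (+ 0)) (ℤ.*-identityˡ c)) refl

  squareMod8-5 : Odd c → SquareMod8 5
  squareMod8-5 (j , c≡2j+1) = 1 + 2 * θ , record
    { residual = - (fromℤ j + θ) , (begin
        - (fromℤ j + θ) * 8                            ≡⟨ expand (fromℤ j) θ ⟩
        5 - (1 + 4 * θ + 4 * (θ + (2 * fromℤ j + 1)))  ≡⟨ cong (λ t → 5 - (1 + 4 * θ + 4 * t)) θ*θ≡θ+2j+1 ⟨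
        5 - (1 + 4 * θ + 4 * (θ * θ))                  ≡⟨ square θ ⟩
        5 - (1 + 2 * θ) * (1 + 2 * θ)                  ∎)
    ; cube≡1   = cube≡1₂-resp {1} {1 + 2 * θ} (0 , refl) (θ , refl) }
    where
    θ*θ≡θ+2j+1 : θ * θ ≡ θ + (2 * fromℤ j + 1)
    θ*θ≡θ+2j+1 = trans θ*θ≡θ+c (trans (cong (λ c → θ + fromℤ c) c≡2j+1)
                                      (cong (λ t → θ + (t + 1)) (fromℤ-* (+ 2) j)))
    expand : ∀ j t → - (j + t) * 8 ≡ 5 - (1 + 4 * t + 4 * (t + (2 * j + 1)))
    expand = solve-∀ ring
    square : ∀ t → 5 - (1 + 4 * t + 4 * (t * t)) ≡ 5 - (1 + 2 * t) * (1 + 2 * t)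
    square = solve-∀ ring

  cube≡1or5⇒squareMod8 : ∀ {z} → Odd c → Cube15 z → SquareMod8 z
  cube≡1or5⇒squareMod8 {z = z} _ (inj₁ z³≡1) =
    squareMod8-cubeRoot 1 (0 , refl) (0 , refl) squareMod8-1 (≡[modₖ]⇒∣ (+ 8) (z * z * z) 1 z³≡1)
  cube≡1or5⇒squareMod8 {z = z} c-odd (inj₂ z³≡5) =
    squareMod8-cubeRoot 5 (- 2 , refl) (- 3 , refl) (squareMod8-5 c-odd) (≡[modₖ]⇒∣ (+ 8) (z * z * z) 5 z³≡5)

  rational-1mod4⇒squareMod8 : ∀ {β} → Odd c → im β ≡ + 0 → β ≡ 1 [modₖ + 4 ] → SquareMod8 β
  rational-1mod4⇒squareMod8 {β} c-odd imβ≡0 (4∣re , _) =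
    [ (λ 8∣re → squareMod8-resp (≡[modₖ]⇒∣ (+ 8) β 1 (8∣re , 8∣im)) squareMod8-1)
    , (λ 8∣re → squareMod8-resp (≡[modₖ]⇒∣ (+ 8) β 5 (8∣re , 8∣im)) (squareMod8-5 c-odd)) ]′
    (≡1mod4⇒≡1or5mod8 (re β) 4∣re)
    where
    8∣im : + 8 ℤᵘ.∣ im β ℤ.- + 0
    8∣im = subst (λ t → + 8 ℤᵘ.∣ t ℤ.- + 0) (sym imβ≡0) (ℕ._∣0 8)

  -- Newton's iteration and square roots in A_ν

  newton-step : ∀ {z n s} → ApproxSqrt z n s →
                Σ OK λ s' → ApproxSqrt z (suc n) s' × 2^ n ∣ s' - s
  newton-step {z} {n} {s} record { residual = q , q[R8]≡z-s² ; cube≡1 = f , f2≡1-s³ } =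
    s + 4 * t , record
      { residual = q * f - R * q * q * (s * s * (s * s)) , (begin
          (q * f - R * q * q * (s * s * (s * s))) * (2^ (1 ℕ.+ n) * 8)
              ≡⟨ cong (λ r → (q * f - R * q * q * (s * s * (s * s))) * (r * 8)) (2^-+ 1 n) ⟩
          (q * f - R * q * q * (s * s * (s * s))) * (2 * R * 8)
              ≡⟨ collect q f R s ⟩
          q * (R * 8) - R * 8 * q + R * 8 * q * (f * 2) - 16 * (R * q * (s * s)) * (R * q * (s * s))
              ≡⟨ cong₂ (λ u v → u - R * 8 * q + R * 8 * q * v - 16 * (R * q * (s * s)) * (R * q * (s * s)))
                       q[R8]≡z-s² f2≡1-s³ ⟩
          (z - s * s) - R * 8 * q + R * 8 * q * (1 - s * s * s) - 16 * (R * q * (s * s)) * (R * q * (s * s))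
              ≡⟨ expand z s R q ⟩
          z - (s + 4 * t) * (s + 4 * t) ∎)
      ; cube≡1 = cube≡1₂-resp {s} {s + 4 * t} (f , f2≡1-s³) (2 * t , step-even s t) }
    , (4 * q * (s * s) , step-small s R q)
    where
    R = 2^ n
    t = R * q * (s * s)
    collect : ∀ q f R s → (q * f - R * q * q * (s * s * (s * s))) * (2 * R * 8)
                        ≡ q * (R * 8) - R * 8 * q + R * 8 * q * (f * 2) - 16 * (R * q * (s * s)) * (R * q * (s * s))
    collect = solve-∀ ring
    expand : ∀ z s R q → (z - s * s) - R * 8 * q + R * 8 * q * (1 - s * s * s) - 16 * (R * q * (s * s)) * (R * q * (s * s))
                       ≡ z - (s + 4 * (R * q * (s * s))) * (s + 4 * (R * q * (s * s)))
    expand = solve-∀ ring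
    step-even : ∀ s t → 2 * t * 2 ≡ s + 4 * t - s
    step-even = solve-∀ ring
    step-small : ∀ s R q → 4 * q * (s * s) * R ≡ s + 4 * (R * q * (s * s)) - s
    step-small = solve-∀ ring

  approxSqrt : ∀ {z} → SquareMod8 z → ∀ n → Σ OK (ApproxSqrt z n)
  approxSqrt s₀ zero    = s₀
  approxSqrt s₀ (suc n) = proj₁ step , proj₁ (proj₂ step)
    where step = newton-step (proj₂ (approxSqrt s₀ n))

  approxSqrt-coherent : ∀ {z} (s₀ : SquareMod8 z) n →
                        2^ n ∣ proj₁ (approxSqrt s₀ (suc n)) - proj₁ (approxSqrt s₀ n)
  approxSqrt-coherent s₀ n = proj₂ (proj₂ (newton-step (proj₂ (approxSqrt s₀ n))))

  fromCoherent : (s : ℕ → OK) → (∀ n → 2^ n ∣ s (suc n) - s n) → Aν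
  fromCoherent s coh = record { seq = s ; coh = λ n → ∣⇒≡[modₖ] (pow2 n) (s (suc n)) (s n) (coh n) }

  const : OK → Aν
  const x = fromCoherent (λ _ → x) (λ n → 0 , x-x≡0 x (2^ n))
    where
    x-x≡0 : ∀ x R → 0 * R ≡ x - x
    x-x≡0 = solve-∀ ring

  ∣-*ˡ : ∀ a {m} x y → m ∣ x - y → m ∣ a * x - a * y
  ∣-*ˡ a {m} x y (q , qm≡x-y) = a * q , (begin
    a * q * m       ≡⟨ solve (a ∷ q ∷ m ∷ []) ring ⟩
    a * (q * m)     ≡⟨ cong (a *_) qm≡x-y ⟩
    a * (x - y)     ≡⟨ solve (a ∷ x ∷ y ∷ []) ring ⟩
    a * x - a * y   ∎)

  ApproxSqrt-scaled : ∀ {z n s} → ApproxSqrt z n s → ∀ P → 2^ n ∣ P * s * (P * s) - P * P * z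
  ApproxSqrt-scaled {z} {n} {s} record { residual = q , q[R8]≡ } P = - (P * P * q * 8) , (begin
    - (P * P * q * 8) * 2^ n        ≡⟨ regroup P q (2^ n) ⟩
    - (P * P * (q * (2^ n * 8)))    ≡⟨ cong (λ d → - (P * P * d)) q[R8]≡ ⟩
    - (P * P * (z - s * s))         ≡⟨ solve (P ∷ z ∷ s ∷ []) ring ⟩
    P * s * (P * s) - P * P * z     ∎)
    where
    regroup : ∀ P q R → - (P * P * q * 8) * R ≡ - (P * P * (q * (R * 8)))
    regroup = solve-∀ ring

  -- Points of C

  quartic : OK → OK → OK → OK → OK → OK
  quartic a b₁ b₂ u w = b₁ * u * u * u * u + a * u * u * w * w + b₂ * w * w * w * w

  record SquareValue (a b₁ b₂ : OK) : Set where
    field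
      u w        : OK
      nontrivial : ¬ (u ≡ 0ₖ × w ≡ 0ₖ)
      T          : ℕ
      z          : OK
      z-square   : SquareMod8 z
      value      : quartic a b₁ b₂ u w ≡ 2^ T * 2^ T * z

  squareValue-swap : ∀ {a b₁ b₂} → SquareValue a b₂ b₁ → SquareValue a b₁ b₂
  squareValue-swap {a} {b₁} {b₂} sv = record
    { u = w ; w = u ; nontrivial = λ (w≡0 , u≡0) → nontrivial (u≡0 , w≡0)
    ; T = T ; z = z ; z-square = z-square
    ; value = trans (symmetric a b₁ b₂ u w) value }
    where
    open SquareValue sv
    symmetric : ∀ a b₁ b₂ u w → b₁ * w * w * w * w + a * w * w * u * u + b₂ * u * u * u * u
                              ≡ b₂ * u * u * u * u + a * u * u * w * w + b₁ * w * w * w * w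
    symmetric = solve-∀ ring

  squareValue⇒point : ∀ {a b₁ b₂} → SquareValue a b₁ b₂ → CHasKνPoint c a b₁ b₂
  squareValue⇒point {a} {b₁} {b₂} sv =
    const u /2^ 0 , fromCoherent v v-coherent /2^ 0 , const w /2^ 0 ,
    -- all denominators are 2^0, so OnC multiplies every term by pow2 0
    (λ n → subst₂ (λ x y → x ≡ y [modₖ pow2 n ]) (sym (pow2-0·x≡x (v n * v n)))
             (sym (unscale (b₁ * u * u * u * u) (a * u * u * w * w) (b₂ * w * w * w * w)))
             (v²≡F n)) ,
    (λ (u≈0 , w≈0) → nontrivial (≈0⇒≡0 u≈0 , ≈0⇒≡0 w≈0))
    where
    open SquareValue sv
    s : ℕ → OK
    s n = proj₁ (approxSqrt z-square n)
    v : ℕ → OK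
    v n = 2^ T * s n
    v-coherent : ∀ n → 2^ n ∣ v (suc n) - v n
    v-coherent n = ∣-*ˡ (2^ T) (s (suc n)) (s n) (approxSqrt-coherent z-square n)
    v²≡F : ∀ n → (v n * v n) ≡ quartic a b₁ b₂ u w [modₖ pow2 n ]
    v²≡F n = ∣⇒≡[modₖ] (pow2 n) (v n * v n) (quartic a b₁ b₂ u w) (subst (λ F → 2^ n ∣ v n * v n - F) (sym value)
               (ApproxSqrt-scaled (proj₂ (approxSqrt z-square n)) (2^ T)))
    unscale : ∀ x y z → pow2 0 · (pow2 0 · (pow2 0 · x + pow2 0 · y) + pow2 0 · z) ≡ x + y + z
    unscale x y z = trans (pow2-0·x≡x _)
                          (cong₂ _+_ (trans (pow2-0·x≡x _) (cong₂ _+_ (pow2-0·x≡x x) (pow2-0·x≡x y))) (pow2-0·x≡x z))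
    ≈0⇒≡0 : ∀ {x} → (∀ n → (pow2 0 · x) ≡ (pow2 0 · 0ₖ) [modₖ pow2 n ]) → x ≡ 0ₖ
    ≈0⇒≡0 {x} x≈0 = trans (sym (pow2-0·x≡x x)) (trans (2-adically-separated x≈0) (pow2-0·x≡x 0ₖ))

  2^-*2 : ∀ m → 2^ (m ℕ.* 2) ≡ 2^ m * 2^ m
  2^-*2 m = trans (cong 2^_ (trans (ℕ.*-comm m 2) (cong (m ℕ.+_) (ℕ.+-identityʳ m)))) (2^-+ m m)

  2^-+3+ : ∀ k r → 2^ (k ℕ.+ 3 ℕ.+ r) ≡ 2^ k * 8 * 2^ r
  2^-+3+ k r = trans (2^-+ (k ℕ.+ 3) r) (cong (_* 2^ r) (2^-+ k 3))

  2^-+₄ : ∀ p q r s → 2^ (p ℕ.+ q ℕ.+ r ℕ.+ s) ≡ 2^ p * 2^ q * 2^ r * 2^ s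
  2^-+₄ p q r s = trans (2^-+ (p ℕ.+ q ℕ.+ r) s) (cong (_* 2^ s) (trans (2^-+ (p ℕ.+ q) r) (cong (_* 2^ r) (2^-+ p q))))

  2^≢0 : ∀ m → ¬ 2^ m ≡ 0ₖ
  2^≢0 m 2^m≡0 = ℕ.<⇒≢ (ℕ.m^n>0 2 m) (sym (ℤ.+-injective (cong re 2^m≡0)))

  half : ∀ {k} → EvenN k → ℕ
  half = ℕ._∣_.quotient

  2^-even : ∀ {k} (k-even : EvenN k) → 2^ k ≡ 2^ half k-even * 2^ half k-even
  2^-even (ℕ.divides m k≡m*2) = trans (cong 2^_ k≡m*2) (2^-*2 m)

  ·≡* : ∀ {b K} k β → b ≡ pow2 k · β → 2^ k ≡ K → b ≡ K * β
  ·≡* k β b≡ 2^k≡K = trans b≡ (trans (·-as-* (pow2 k) β) (cong (_* β) 2^k≡K))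

  rational-unit-part : ∀ {b} k β → b ≡ pow2 k · β → im b ≡ + 0 → im β ≡ + 0
  rational-unit-part k β refl imb≡0 with ℤ.i*j≡0⇒i≡0∨j≡0 (pow2 k) imb≡0
  ... | inj₂ imβ≡0 = imβ≡0
  ... | inj₁ 2^k≡0 = ⊥-elim (2^≢0 k (cong fromℤ 2^k≡0))

  monomial-2^ : ∀ {b E} k β e → b ≡ pow2 k · β → 2^ e ≡ E → b * E ≡ 2^ (k ℕ.+ e) * β
  monomial-2^ {b} {E} k β e b≡ 2^e≡E = begin
    b * E                ≡⟨ cong₂ _*_ (·≡* k β b≡ refl) (sym 2^e≡E) ⟩
    2^ k * β * 2^ e      ≡⟨ swap (2^ k) β (2^ e) ⟩
    2^ k * 2^ e * β      ≡⟨ cong (_* β) (2^-+ k e) ⟨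
    2^ (k ℕ.+ e) * β     ∎
    where
    swap : ∀ K β E → K * β * E ≡ K * E * β
    swap = solve-∀ ring

  quartic-2^ : ∀ {a b₁ b₂} kₐ k₁ k₂ α β₁ β₂ →
               a ≡ pow2 kₐ · α → b₁ ≡ pow2 k₁ · β₁ → b₂ ≡ pow2 k₂ · β₂ → ∀ x y →
               quartic a b₁ b₂ (2^ x) (2^ y) ≡ 2^ (k₁ ℕ.+ (x ℕ.+ x ℕ.+ x ℕ.+ x)) * β₁
                                              + 2^ (kₐ ℕ.+ (x ℕ.+ x ℕ.+ y ℕ.+ y)) * α
                                              + 2^ (k₂ ℕ.+ (y ℕ.+ y ℕ.+ y ℕ.+ y)) * β₂
  quartic-2^ {a} {b₁} {b₂} kₐ k₁ k₂ α β₁ β₂ a≡ b₁≡ b₂≡ x y =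
    trans (regroup a b₁ b₂ (2^ x) (2^ y))
          (cong₂ _+_ (cong₂ _+_ (monomial-2^ k₁ β₁ _ b₁≡ (2^-+₄ x x x x))
                                (monomial-2^ kₐ α _ a≡ (2^-+₄ x x y y)))
                     (monomial-2^ k₂ β₂ _ b₂≡ (2^-+₄ y y y y)))
    where
    regroup : ∀ a b₁ b₂ X Y → b₁ * X * X * X * X + a * X * X * Y * Y + b₂ * Y * Y * Y * Y
                            ≡ b₁ * (X * X * X * X) + a * (X * X * Y * Y) + b₂ * (Y * Y * Y * Y)
    regroup = solve-∀ ring

  squareValue-b₁ : ∀ {a b₁ b₂} k β → b₁ ≡ pow2 k · β → EvenN k → SquareMod8 β → SquareValue a b₁ b₂
  squareValue-b₁ {a} {b₁} {b₂} k β b₁≡ k-even β-square = record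
    { u = 1# ; w = 0# ; nontrivial = λ { (() , _) }
    ; T = half k-even ; z = β ; z-square = β-square
    ; value = trans (at-1-0 a b₁ b₂) (·≡* k β b₁≡ (2^-even k-even)) }
    where
    at-1-0 : ∀ a b₁ b₂ → b₁ * 1# * 1# * 1# * 1# + a * 1# * 1# * 0# * 0# + b₂ * 0# * 0# * 0# * 0# ≡ b₁
    at-1-0 = solve-∀ ring

  squareValue-a : ∀ {a b₁ b₂} kₐ k₁ k₂ α β₁ β₂ →
                  a ≡ pow2 kₐ · α → b₁ ≡ pow2 k₁ · β₁ → b₂ ≡ pow2 k₂ · β₂ →
                  kₐ ℕ.+ 3 ≤ k₁ → kₐ ℕ.+ 3 ≤ k₂ → EvenN kₐ → SquareMod8 α → SquareValue a b₁ b₂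
  squareValue-a {a} {b₁} {b₂} kₐ k₁ k₂ α β₁ β₂ a≡ b₁≡ b₂≡ kₐ+3≤k₁ kₐ+3≤k₂ kₐ-even α-square = record
    { u = 1# ; w = 1# ; nontrivial = λ { (() , _) }
    ; T = half kₐ-even ; z = α + 8 * (R₁ * β₁ + R₂ * β₂)
    ; z-square = squareMod8-+8* α-square (R₁ * β₁ + R₂ * β₂)
    ; value = begin
        quartic a b₁ b₂ 1# 1#
          ≡⟨ at-1-1 a b₁ b₂ ⟩
        b₁ + a + b₂
          ≡⟨ cong₂ _+_ (cong₂ _+_ (·≡* k₁ β₁ b₁≡ (2^k≡ kₐ+3≤k₁)) (·≡* kₐ α a≡ refl))
                       (·≡* k₂ β₂ b₂≡ (2^k≡ kₐ+3≤k₂)) ⟩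
        2^ kₐ * 8 * R₁ * β₁ + 2^ kₐ * α + 2^ kₐ * 8 * R₂ * β₂
          ≡⟨ factor (2^ kₐ) α β₁ β₂ R₁ R₂ ⟩
        2^ kₐ * (α + 8 * (R₁ * β₁ + R₂ * β₂))
          ≡⟨ cong (_* (α + 8 * (R₁ * β₁ + R₂ * β₂))) (2^-even kₐ-even) ⟩
        2^ m * 2^ m * (α + 8 * (R₁ * β₁ + R₂ * β₂)) ∎ }
    where
    m = half kₐ-even
    gap : ∀ {k} → kₐ ℕ.+ 3 ≤ k → ℕ
    gap le = proj₁ (ℕ.m≤n⇒∃[o]m+o≡n le)
    2^k≡ : ∀ {k} (le : kₐ ℕ.+ 3 ≤ k) → 2^ k ≡ 2^ kₐ * 8 * 2^ gap le
    2^k≡ le = trans (cong 2^_ (sym (proj₂ (ℕ.m≤n⇒∃[o]m+o≡n le)))) (2^-+3+ kₐ (gap le))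
    R₁ = 2^ gap kₐ+3≤k₁
    R₂ = 2^ gap kₐ+3≤k₂
    at-1-1 : ∀ a b₁ b₂ → b₁ * 1# * 1# * 1# * 1# + a * 1# * 1# * 1# * 1# + b₂ * 1# * 1# * 1# * 1#
                       ≡ b₁ + a + b₂
    at-1-1 = solve-∀ ring
    factor : ∀ K α β₁ β₂ R₁ R₂ → K * 8 * R₁ * β₁ + K * α + K * 8 * R₂ * β₂
                               ≡ K * (α + 8 * (R₁ * β₁ + R₂ * β₂))
    factor = solve-∀ ring

  -- At (u, w) = (2^m, 2^m₁), where kₐ = 2m and k₁ = 2m₁, the b₁- and a-terms of F have
  -- 2-adic valuation 2T and the b₂-term at least 2T + 3.
  squareValue-a+b₁ : ∀ {a b₁ b₂} kₐ k₁ k₂ α β₁ β₂ →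
                     a ≡ pow2 kₐ · α → b₁ ≡ pow2 k₁ · β₁ → b₂ ≡ pow2 k₂ · β₂ →
                     2 ℕ.* kₐ ℕ.+ 3 ≤ k₁ ℕ.+ k₂ → EvenN kₐ → EvenN k₁ → SquareMod8 (α + β₁) → SquareValue a b₁ b₂
  squareValue-a+b₁ {a} {b₁} {b₂} kₐ k₁ k₂ α β₁ β₂ a≡ b₁≡ b₂≡ 2kₐ+3≤k₁+k₂
                   (ℕ.divides m kₐ≡m*2) (ℕ.divides m₁ k₁≡m₁*2) α+β₁-square = record
    { u = 2^ m ; w = 2^ m₁ ; nontrivial = λ (2^m≡0 , _) → 2^≢0 m 2^m≡0
    ; T = T ; z = α + β₁ + 8 * (2^ r * β₂)
    ; z-square = squareMod8-+8* α+β₁-square (2^ r * β₂)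
    ; value = begin
        quartic a b₁ b₂ (2^ m) (2^ m₁)
          ≡⟨ quartic-2^ kₐ k₁ k₂ α β₁ β₂ a≡ b₁≡ b₂≡ m m₁ ⟩
        2^ (k₁ ℕ.+ (m ℕ.+ m ℕ.+ m ℕ.+ m)) * β₁ + 2^ (kₐ ℕ.+ (m ℕ.+ m ℕ.+ m₁ ℕ.+ m₁)) * α
          + 2^ (k₂ ℕ.+ (m₁ ℕ.+ m₁ ℕ.+ m₁ ℕ.+ m₁)) * β₂
          ≡⟨ cong₂ _+_ (cong₂ _+_ (cong (λ e → 2^ e * β₁) e₁) (cong (λ e → 2^ e * α) eₐ))
                       (cong (λ e → 2^ e * β₂) e₂) ⟩
        2^ (T ℕ.+ T) * β₁ + 2^ (T ℕ.+ T) * α + 2^ (T ℕ.+ T ℕ.+ 3 ℕ.+ r) * β₂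
          ≡⟨ cong₂ _+_ (cong₂ _+_ (cong (_* β₁) (2^-+ T T)) (cong (_* α) (2^-+ T T)))
                       (cong (_* β₂) (2^-+₄ T T 3 r)) ⟩
        2^ T * 2^ T * β₁ + 2^ T * 2^ T * α + 2^ T * 2^ T * 8 * 2^ r * β₂
          ≡⟨ factor (2^ T) α β₁ β₂ (2^ r) ⟩
        2^ T * 2^ T * (α + β₁ + 8 * (2^ r * β₂)) ∎ }
    where
    T = m ℕ.+ m ℕ.+ m₁
    r = proj₁ (ℕ.m≤n⇒∃[o]m+o≡n 2kₐ+3≤k₁+k₂)
    exponents = condition3-exponents k₂ m m₁ r kₐ≡m*2 k₁≡m₁*2
                                     (proj₂ (ℕ.m≤n⇒∃[o]m+o≡n 2kₐ+3≤k₁+k₂))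
    e₁ = proj₁ exponents
    eₐ = proj₁ (proj₂ exponents)
    e₂ = proj₂ (proj₂ exponents)
    factor : ∀ P α β₁ β₂ R → P * P * β₁ + P * P * α + P * P * 8 * R * β₂
                            ≡ P * P * (α + β₁ + 8 * (R * β₂))
    factor = solve-∀ ring

lemma3p4 : (d : ℤ) → SquareFree d → TwoInert d →
           (a b₁ b₂ : OK) → ¬ (a ≡ 0ₖ) → ¬ (b₁ ≡ 0ₖ) → ¬ (b₂ ≡ 0ₖ) →
           (kₐ k₁ k₂ : ℕ) (α β₁ β₂ : OK) →
           IsUnit₂ α → IsUnit₂ β₁ → IsUnit₂ β₂ →
           a ≡ Arith._·_ (cOf d) (pow2 kₐ) α →
           b₁ ≡ Arith._·_ (cOf d) (pow2 k₁) β₁ →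
           b₂ ≡ Arith._·_ (cOf d) (pow2 k₂) β₂ →
           0 < kₐ →
           Conds.AnyCond (cOf d) a b₁ b₂ kₐ k₁ k₂ α β₁ β₂ →
           CHasKνPoint (cOf d) a b₁ b₂
lemma3p4 d _ two-inert a b₁ b₂ _ _ _ kₐ k₁ k₂ α β₁ β₂ _ _ _ a≡ b₁≡ b₂≡ _ =
  squareValue⇒point ∘ squareValue
  where
  open TwoAdic (cOf d)
  c-odd = cOf-odd d two-inert
  squareValue : Conds.AnyCond (cOf d) a b₁ b₂ kₐ k₁ k₂ α β₁ β₂ → SquareValue a b₁ b₂
  squareValue (inj₁ (inj₁ (k₁-even , β₁³≡1,5))) =
    squareValue-b₁ k₁ β₁ b₁≡ k₁-even (cube≡1or5⇒squareMod8 c-odd β₁³≡1,5)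
  squareValue (inj₁ (inj₂ (k₂-even , β₂³≡1,5))) =
    squareValue-swap (squareValue-b₁ k₂ β₂ b₂≡ k₂-even (cube≡1or5⇒squareMod8 c-odd β₂³≡1,5))
  squareValue (inj₂ (inj₁ (inj₁ (b₁∈ℤ , k₁-even , β₁≡1)))) =
    squareValue-b₁ k₁ β₁ b₁≡ k₁-even
      (rational-1mod4⇒squareMod8 c-odd (rational-unit-part k₁ β₁ b₁≡ b₁∈ℤ) β₁≡1)
  squareValue (inj₂ (inj₁ (inj₂ (b₂∈ℤ , k₂-even , β₂≡1)))) =
    squareValue-swap (squareValue-b₁ k₂ β₂ b₂≡ k₂-even
      (rational-1mod4⇒squareMod8 c-odd (rational-unit-part k₂ β₂ b₂≡ b₂∈ℤ) β₂≡1))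
  squareValue (inj₂ (inj₂ (inj₁ (kₐ+3≤k₁ , kₐ+3≤k₂ , kₐ-even , α³≡1,5)))) =
    squareValue-a kₐ k₁ k₂ α β₁ β₂ a≡ b₁≡ b₂≡ kₐ+3≤k₁ kₐ+3≤k₂ kₐ-even (cube≡1or5⇒squareMod8 c-odd α³≡1,5)
  squareValue (inj₂ (inj₂ (inj₂ (inj₁ (kₐ+3≤k₁ , kₐ+3≤k₂ , kₐ-even , a∈ℤ , α≡1))))) =
    squareValue-a kₐ k₁ k₂ α β₁ β₂ a≡ b₁≡ b₂≡ kₐ+3≤k₁ kₐ+3≤k₂ kₐ-even
      (rational-1mod4⇒squareMod8 c-odd (rational-unit-part kₐ α a≡ a∈ℤ) α≡1)
  squareValue (inj₂ (inj₂ (inj₂ (inj₂ (2kₐ+3≤k₁+k₂ , kₐ-even , inj₁ (k₁-even , α+β₁³≡1,5)))))) =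
    squareValue-a+b₁ kₐ k₁ k₂ α β₁ β₂ a≡ b₁≡ b₂≡ 2kₐ+3≤k₁+k₂ kₐ-even k₁-even
      (cube≡1or5⇒squareMod8 c-odd α+β₁³≡1,5)
  squareValue (inj₂ (inj₂ (inj₂ (inj₂ (2kₐ+3≤k₁+k₂ , kₐ-even , inj₂ (k₂-even , α+β₂³≡1,5)))))) =
    squareValue-swap (squareValue-a+b₁ kₐ k₂ k₁ α β₂ β₁ a≡ b₂≡ b₁≡
      (subst (2 ℕ.* kₐ ℕ.+ 3 ≤_) (ℕ.+-comm k₁ k₂) 2kₐ+3≤k₁+k₂) kₐ-even k₂-even
      (cube≡1or5⇒squareMod8 c-odd α+β₂³≡1,5))
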